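{- The formula $\forall l(list\,l\supset split\,l\,nil\,l)$ is derivable in $FO\lambda^{\Delta\mathbb{N}}$ using the definition $\mathcal{D}_{list}(\tau)$.
   Context: $FO\lambda^{\Delta\mathbb{N}}$ is the following intuitionistic sequent calculus. Terms are simply typed $\lambda$-terms (up to $\alpha\beta\eta$-conversion) over a signature of typed constants; $o$ is the type of formulas, and quantifiers range only over types not containing $o$. Formulas are built from atomic formulas with $\bot,\top,\land,\lor,\supset,\forall,\exists$. There is a type $nt$ with constants $z:nt$, $s:nt\to nt$ and a predicate $nat: nt\to o$. Sequents are $\Gamma\longrightarrow B$, $\Gamma$ a finite multiset. Rules: $\bot,\Gamma\longrightarrow B$ and $\Gamma\longrightarrow\top$ are axioms; the usual intuitionistic left and right rules for $\land,\lor,\supset,\forall,\exists$ (with the usual eigenvariable conditions); initial sequents $A,\Gamma\longrightarrow A$ for atomic $A$; left contraction; cut. For $nat$: $\Gamma\longrightarrow nat\,z$; from $\Gamma\longrightarrow nat\,I$ infer $\Gamma\longrightarrow nat\,(s\,I)$; induction: for $B:nt\to o$ and eigenvariable $j$ not free in $B$, from $\longrightarrow B\,z$, $B\,j\longrightarrow B\,(s\,j)$, $B\,I,\Gamma\longrightarrow C$ infer $nat\,I,\Gamma\longrightarrow C$. Relative to a definition (set of clauses $\forall\bar x[p\,\bar t\triangleq B]$, free variables of $B$ occurring in $\bar t$, satisfying a level condition): right rule: from $\Gamma\longrightarrow B\theta$ infer $\Gamma\longrightarrow p\,\bar u$ when $p\,\bar u=(p\,\bar t)\theta$; left rule: infer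 $p\,\bar u,\Gamma\longrightarrow C$ from the premises $B\theta,\Gamma\theta\longrightarrow C\theta$ for every clause (renamed apart) and every $\theta$ in a complete set of unifiers of $p\,\bar u$ and $p\,\bar t$. A formula is derivable using a definition if $\longrightarrow F$ has a derivation. For a fixed type $\tau$, $lst$ is a type with constants $nil: lst$ and infix $::\,:\tau\to lst\to lst$. $\mathcal{D}_{list}(\tau)$ is the definition with predicates $length: lst\to nt\to o$, $list: lst\to o$, $element:\tau\to lst\to o$, $split: lst\to lst\to lst\to o$, $permute: lst\to lst\to o$ and clauses: $length\,nil\,z\triangleq\top$; $length\,(X::L)\,(s\,I)\triangleq length\,L\,I$; $list\,L\triangleq\exists i(nat\,i\land length\,L\,i)$; $element\,X\,(X::L)\triangleq\top$; $element\,X\,(Y::L)\triangleq element\,X\,L$; $split\,nil\,nil\,nil\triangleq\top$; $split\,(X::L_1)\,(X::L_2)\,L_3\triangleq split\,L_1\,L_2\,L_3$; $split\,(X::L_1)\,L_2\,(X::L_3)\triangleq split\,L_1\,L_2\,L_3$; $permute\,nil\,nil\triangleq\top$; $permute\,(X::L_1)\,L_2\triangleq\exists l_{22}(split\,L_2\,(X::nil)\,l_{22}\land permute\,L_1\,l_{22})$. -}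

module Defs where

open import Data.List using (List; []; _∷_; _++_; map)
open import Data.List.Relation.Unary.All using (All)
open import Data.List.Relation.Unary.Any using (Any)
open import Data.List.Membership.Propositional using (_∈_)
open import Data.List.Relation.Binary.Permutation.Propositional using (_↭_)
open import Data.Product using (Σ; Σ-syntax; _×_; _,_)
open import Relation.Binary.PropositionalEquality using (_≡_)

data Sort : Set where
  nt lst tau : Sort

Ctx : Set
Ctx = List Sort

data Var : Ctx → Sort → Set where
  vz : ∀ {Γ σ} → Var (σ ∷ Γ) σ
  vs : ∀ {Γ σ ρ} → Var Γ σ → Var (ρ ∷ Γ) σ

-- The defined predicates of 𝒟_list(τ).  (nat is treated separately.)
data Pred : Set where
  lengthP listP elementP splitP permuteP : Pred

arity : Pred → List Sort
arity lengthP  = lst ∷ nt ∷ []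
arity listP    = lst ∷ []
arity elementP = tau ∷ lst ∷ []
arity splitP   = lst ∷ lst ∷ lst ∷ []
arity permuteP = lst ∷ lst ∷ []

-- K σ : the (arbitrary) further constants of the signature of type σ.
module Logic (K : Sort → Set) where

  infixr 5 _::_
  data Tm (Γ : Ctx) : Sort → Set where
    var  : ∀ {σ} → Var Γ σ → Tm Γ σ
    con  : ∀ {σ} → K σ → Tm Γ σ
    z    : Tm Γ nt
    s    : Tm Γ nt → Tm Γ nt
    nil  : Tm Γ lst
    _::_ : Tm Γ tau → Tm Γ lst → Tm Γ lst

  data Args (Γ : Ctx) : List Sort → Set where
    []  : Args Γ []
    _∷_ : ∀ {σ ss} → Tm Γ σ → Args Γ ss → Args Γ (σ ∷ ss)

  infixr 6 _∧'_
  infixr 5 _∨'_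
  infixr 4 _⊃_
  data Fm (Γ : Ctx) : Set where
    ⊥' ⊤'          : Fm Γ
    _∧'_ _∨'_ _⊃_  : Fm Γ → Fm Γ → Fm Γ
    all ex         : (σ : Sort) → Fm (σ ∷ Γ) → Fm Γ
    nat            : Tm Γ nt → Fm Γ
    atm            : (p : Pred) → Args Γ (arity p) → Fm Γ

  data Atomic {Γ : Ctx} : Fm Γ → Set where
    natA : ∀ t → Atomic (nat t)
    atmA : ∀ p us → Atomic (atm p us)

  Ren : Ctx → Ctx → Set
  Ren Γ Δ = ∀ {σ} → Var Γ σ → Var Δ σ

  Sub : Ctx → Ctx → Set
  Sub Γ Δ = ∀ {σ} → Var Γ σ → Tm Δ σ

  extR : ∀ {Γ Δ ρ} → Ren Γ Δ → Ren (ρ ∷ Γ) (ρ ∷ Δ)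
  extR r vz     = vz
  extR r (vs x) = vs (r x)

  renT : ∀ {Γ Δ σ} → Ren Γ Δ → Tm Γ σ → Tm Δ σ
  renT r (var x)  = var (r x)
  renT r (con c)  = con c
  renT r z        = z
  renT r (s t)    = s (renT r t)
  renT r nil      = nil
  renT r (x :: l) = renT r x :: renT r l

  renA : ∀ {Γ Δ ss} → Ren Γ Δ → Args Γ ss → Args Δ ss
  renA r []       = []
  renA r (t ∷ ts) = renT r t ∷ renA r ts

  renF : ∀ {Γ Δ} → Ren Γ Δ → Fm Γ → Fm Δ
  renF r ⊥'        = ⊥'
  renF r ⊤'        = ⊤'
  renF r (A ∧' B)  = renF r A ∧' renF r B
  renF r (A ∨' B)  = renF r A ∨' renF r B
  renF r (A ⊃ B)   = renF r A ⊃ renF r B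
  renF r (all σ A) = all σ (renF (extR r) A)
  renF r (ex σ A)  = ex σ (renF (extR r) A)
  renF r (nat t)   = nat (renT r t)
  renF r (atm p u) = atm p (renA r u)

  wkF : ∀ {Γ ρ} → Fm Γ → Fm (ρ ∷ Γ)
  wkF = renF vs

  extS : ∀ {Γ Δ ρ} → Sub Γ Δ → Sub (ρ ∷ Γ) (ρ ∷ Δ)
  extS θ vz     = var vz
  extS θ (vs x) = renT vs (θ x)

  subT : ∀ {Γ Δ σ} → Sub Γ Δ → Tm Γ σ → Tm Δ σ
  subT θ (var x)  = θ x
  subT θ (con c)  = con c
  subT θ z        = z
  subT θ (s t)    = s (subT θ t)
  subT θ nil      = nil
  subT θ (x :: l) = subT θ x :: subT θ l

  subA : ∀ {Γ Δ ss} → Sub Γ Δ → Args Γ ss → Args Δ ss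
  subA θ []       = []
  subA θ (t ∷ ts) = subT θ t ∷ subA θ ts

  subF : ∀ {Γ Δ} → Sub Γ Δ → Fm Γ → Fm Δ
  subF θ ⊥'        = ⊥'
  subF θ ⊤'        = ⊤'
  subF θ (A ∧' B)  = subF θ A ∧' subF θ B
  subF θ (A ∨' B)  = subF θ A ∨' subF θ B
  subF θ (A ⊃ B)   = subF θ A ⊃ subF θ B
  subF θ (all σ A) = all σ (subF (extS θ) A)
  subF θ (ex σ A)  = ex σ (subF (extS θ) A)
  subF θ (nat t)   = nat (subT θ t)
  subF θ (atm p u) = atm p (subA θ u)

  sub0 : ∀ {Γ σ} → Tm Γ σ → Sub (σ ∷ Γ) Γ
  sub0 t vz     = t
  sub0 t (vs x) = var x

  inst : ∀ {Γ σ} → Fm (σ ∷ Γ) → Tm Γ σ → Fm Γ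
  inst A t = subF (sub0 t) A

  -- substitution j ↦ s j (keeping j as the first variable): used for B (s j)
  succ0 : ∀ {Γ} → Sub (nt ∷ Γ) (nt ∷ Γ)
  succ0 vz     = s (var vz)
  succ0 (vs x) = var (vs x)

  -- Definitions: a clause  ∀x̄ [p t̄ ≜ B]  with clause variables x̄ = vars,
  -- grouped by head predicate.
  record Clause (p : Pred) : Set where
    field
      vars : Ctx
      head : Args vars (arity p)
      body : Fm vars

  Definition : Set
  Definition = (p : Pred) → List (Clause p)

  -- Unifiers of  p ū  (ū over the eigenvariables Σ) and  p t̄
  -- (t̄ over the clause variables Δ, renamed apart from Σ).
  -- A unifier is a substitution for all of Σ,Δ into a new eigenvariable
  -- context, given as its two parts.
  record Unifier {Σ' Δ : Ctx} {ss : List Sort}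
                 (u : Args Σ' ss) (t : Args Δ ss) : Set where
    field
      ctx   : Ctx
      θΣ    : Sub Σ' ctx
      θΔ    : Sub Δ ctx
      unif  : subA θΣ u ≡ subA θΔ t

  _≼_ : ∀ {Σ' Δ ss} {u : Args Σ' ss} {t : Args Δ ss} →
        Unifier u t → Unifier u t → Set
  ρ ≼ θ = Σ[ η ∈ Sub (Unifier.ctx θ) (Unifier.ctx ρ) ]
            ((∀ {σ} (x : Var _ σ) → Unifier.θΣ ρ x ≡ subT η (Unifier.θΣ θ x))
           × (∀ {σ} (x : Var _ σ) → Unifier.θΔ ρ x ≡ subT η (Unifier.θΔ θ x)))

  CSU : ∀ {Σ' Δ ss} {u : Args Σ' ss} {t : Args Δ ss} →
        List (Unifier u t) → Set
  CSU {u = u} {t} S = (ρ : Unifier u t) → Any (λ θ → ρ ≼ θ) S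

  -- Sequents  Σ ; Γ ⟶ C  (Σ the eigenvariables, Γ a multiset, realised
  -- as a list together with an exchange rule).
  infix 2 _⨾_⊢_⟶_
  data _⨾_⊢_⟶_ (D : Definition) (Σ' : Ctx) : List (Fm Σ') → Fm Σ' → Set where
    exch  : ∀ {Γ Γ' C} → Γ ↭ Γ' → D ⨾ Σ' ⊢ Γ ⟶ C → D ⨾ Σ' ⊢ Γ' ⟶ C
    botL  : ∀ {Γ C} → D ⨾ Σ' ⊢ ⊥' ∷ Γ ⟶ C
    topR  : ∀ {Γ} → D ⨾ Σ' ⊢ Γ ⟶ ⊤'
    init  : ∀ {Γ A} → Atomic A → D ⨾ Σ' ⊢ A ∷ Γ ⟶ A
    contr : ∀ {Γ A C} → D ⨾ Σ' ⊢ A ∷ A ∷ Γ ⟶ C → D ⨾ Σ' ⊢ A ∷ Γ ⟶ C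
    cut   : ∀ {Γ₁ Γ₂ A C} → D ⨾ Σ' ⊢ Γ₁ ⟶ A → D ⨾ Σ' ⊢ A ∷ Γ₂ ⟶ C →
            D ⨾ Σ' ⊢ Γ₁ ++ Γ₂ ⟶ C
    andL₁ : ∀ {Γ A B C} → D ⨾ Σ' ⊢ A ∷ Γ ⟶ C → D ⨾ Σ' ⊢ (A ∧' B) ∷ Γ ⟶ C
    andL₂ : ∀ {Γ A B C} → D ⨾ Σ' ⊢ B ∷ Γ ⟶ C → D ⨾ Σ' ⊢ (A ∧' B) ∷ Γ ⟶ C
    andR  : ∀ {Γ A B} → D ⨾ Σ' ⊢ Γ ⟶ A → D ⨾ Σ' ⊢ Γ ⟶ B → D ⨾ Σ' ⊢ Γ ⟶ A ∧' B
    orL   : ∀ {Γ A B C} → D ⨾ Σ' ⊢ A ∷ Γ ⟶ C → D ⨾ Σ' ⊢ B ∷ Γ ⟶ C →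
            D ⨾ Σ' ⊢ (A ∨' B) ∷ Γ ⟶ C
    orR₁  : ∀ {Γ A B} → D ⨾ Σ' ⊢ Γ ⟶ A → D ⨾ Σ' ⊢ Γ ⟶ A ∨' B
    orR₂  : ∀ {Γ A B} → D ⨾ Σ' ⊢ Γ ⟶ B → D ⨾ Σ' ⊢ Γ ⟶ A ∨' B
    impL  : ∀ {Γ A B C} → D ⨾ Σ' ⊢ Γ ⟶ A → D ⨾ Σ' ⊢ B ∷ Γ ⟶ C →
            D ⨾ Σ' ⊢ (A ⊃ B) ∷ Γ ⟶ C
    impR  : ∀ {Γ A B} → D ⨾ Σ' ⊢ A ∷ Γ ⟶ B → D ⨾ Σ' ⊢ Γ ⟶ A ⊃ B
    allL  : ∀ {Γ σ A C} (t : Tm Σ' σ) → D ⨾ Σ' ⊢ inst A t ∷ Γ ⟶ C →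
            D ⨾ Σ' ⊢ all σ A ∷ Γ ⟶ C
    -- eigenvariable: the new variable vz of the extended context
    allR  : ∀ {Γ σ A} → D ⨾ (σ ∷ Σ') ⊢ map wkF Γ ⟶ A → D ⨾ Σ' ⊢ Γ ⟶ all σ A
    exL   : ∀ {Γ σ A C} → D ⨾ (σ ∷ Σ') ⊢ A ∷ map wkF Γ ⟶ wkF C →
            D ⨾ Σ' ⊢ ex σ A ∷ Γ ⟶ C
    exR   : ∀ {Γ σ A} (t : Tm Σ' σ) → D ⨾ Σ' ⊢ Γ ⟶ inst A t → D ⨾ Σ' ⊢ Γ ⟶ ex σ A
    natZ  : ∀ {Γ} → D ⨾ Σ' ⊢ Γ ⟶ nat z
    natS  : ∀ {Γ I} → D ⨾ Σ' ⊢ Γ ⟶ nat I → D ⨾ Σ' ⊢ Γ ⟶ nat (s I)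
    -- induction with invariant B : nt → o, j the fresh eigenvariable vz
    ind   : ∀ {Γ I C} (B : Fm (nt ∷ Σ')) →
            D ⨾ Σ' ⊢ [] ⟶ inst B z →
            D ⨾ (nt ∷ Σ') ⊢ B ∷ [] ⟶ subF succ0 B →
            D ⨾ Σ' ⊢ inst B I ∷ Γ ⟶ C →
            D ⨾ Σ' ⊢ nat I ∷ Γ ⟶ C
    defR  : ∀ {Γ p} {u : Args Σ' (arity p)} (cl : Clause p) → cl ∈ D p →
            (θ : Sub (Clause.vars cl) Σ') → u ≡ subA θ (Clause.head cl) →
            D ⨾ Σ' ⊢ Γ ⟶ subF θ (Clause.body cl) →
            D ⨾ Σ' ⊢ Γ ⟶ atm p u
    defL  : ∀ {Γ p C} {u : Args Σ' (arity p)} →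
            ((cl : Clause p) → cl ∈ D p →
              Σ[ S ∈ List (Unifier u (Clause.head cl)) ]
                (CSU S ×
                 All (λ θ → D ⨾ Unifier.ctx θ ⊢
                        subF (Unifier.θΔ θ) (Clause.body cl)
                          ∷ map (subF (Unifier.θΣ θ)) Γ
                        ⟶ subF (Unifier.θΣ θ) C) S)) →
            D ⨾ Σ' ⊢ atm p u ∷ Γ ⟶ C

  Derivable : Definition → Fm [] → Set
  Derivable D F = D ⨾ [] ⊢ [] ⟶ F

  private
    v0 : ∀ {Γ σ} → Tm (σ ∷ Γ) σ
    v0 = var vz
    v1 : ∀ {Γ σ ρ} → Tm (ρ ∷ σ ∷ Γ) σ
    v1 = var (vs vz)
    v2 : ∀ {Γ σ ρ ρ'} → Tm (ρ' ∷ ρ ∷ σ ∷ Γ) σ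
    v2 = var (vs (vs vz))
    v3 : ∀ {Γ σ ρ ρ' ρ''} → Tm (ρ'' ∷ ρ' ∷ ρ ∷ σ ∷ Γ) σ
    v3 = var (vs (vs (vs vz)))

  𝒟list : Definition
  -- length nil z ≜ ⊤ ;  length (X::L) (s I) ≜ length L I      [X,L,I]
  𝒟list lengthP =
      record { vars = [] ; head = nil ∷ z ∷ [] ; body = ⊤' }
    ∷ record { vars = tau ∷ lst ∷ nt ∷ []
             ; head = (v0 :: v1) ∷ s v2 ∷ []
             ; body = atm lengthP (v1 ∷ v2 ∷ []) }
    ∷ []
  -- list L ≜ ∃i (nat i ∧ length L i)                           [L]
  𝒟list listP =
      record { vars = lst ∷ []
             ; head = v0 ∷ []
             ; body = ex nt (nat v0 ∧' atm lengthP (v1 ∷ v0 ∷ [])) }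
    ∷ []
  -- element X (X::L) ≜ ⊤  [X,L] ;  element X (Y::L) ≜ element X L  [X,Y,L]
  𝒟list elementP =
      record { vars = tau ∷ lst ∷ []
             ; head = v0 ∷ (v0 :: v1) ∷ []
             ; body = ⊤' }
    ∷ record { vars = tau ∷ tau ∷ lst ∷ []
             ; head = v0 ∷ (v1 :: v2) ∷ []
             ; body = atm elementP (v0 ∷ v2 ∷ []) }
    ∷ []
  -- split nil nil nil ≜ ⊤
  -- split (X::L1) (X::L2) L3 ≜ split L1 L2 L3        [X,L1,L2,L3]
  -- split (X::L1) L2 (X::L3) ≜ split L1 L2 L3        [X,L1,L2,L3]
  𝒟list splitP =
      record { vars = [] ; head = nil ∷ nil ∷ nil ∷ [] ; body = ⊤' }
    ∷ record { vars = tau ∷ lst ∷ lst ∷ lst ∷ []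
             ; head = (v0 :: v1) ∷ (v0 :: v2) ∷ v3 ∷ []
             ; body = atm splitP (v1 ∷ v2 ∷ v3 ∷ []) }
    ∷ record { vars = tau ∷ lst ∷ lst ∷ lst ∷ []
             ; head = (v0 :: v1) ∷ v2 ∷ (v0 :: v3) ∷ []
             ; body = atm splitP (v1 ∷ v2 ∷ v3 ∷ []) }
    ∷ []
  -- permute nil nil ≜ ⊤
  -- permute (X::L1) L2 ≜ ∃l22 (split L2 (X::nil) l22 ∧ permute L1 l22)  [X,L1,L2]
  𝒟list permuteP =
      record { vars = [] ; head = nil ∷ nil ∷ [] ; body = ⊤' }
    ∷ record { vars = tau ∷ lst ∷ lst ∷ []
             ; head = (v0 :: v1) ∷ v2 ∷ []
             ; body = ex lst (atm splitP (v3 ∷ (v1 :: nil) ∷ v0 ∷ [])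
                              ∧' atm permuteP (v2 ∷ v0 ∷ [])) }
    ∷ []

  listSplitNil : Fm []
  listSplitNil = all lst (atm listP (v0 ∷ []) ⊃ atm splitP (v0 ∷ nil ∷ v0 ∷ []))

-- The invariant  B j = ∀l (length l j ⊃ split l nil l)  is proved for every natural j by the
-- induction rule.  At j = z the only clause for length forces l = nil, and split nil nil nil
-- holds outright; at s j it forces l = x :: l' with length l' j, and split (x :: l') nil (x :: l')
-- follows from split l' nil l' by the third split clause.  Unfolding list l yields a natural i
-- with length l i, and the instance of B at i finishes the proof.
module Submission where

open import Defs
open import Data.Empty using (⊥; ⊥-elim)
open import Data.List using (List; []; _∷_; map)
open import Data.List.Membership.Propositional using (_∈_)
open import Data.List.Relation.Binary.Permutation.Propositional using (swap; refl)
open import Data.List.Relation.Unary.All using (All; []; _∷_)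
open import Data.List.Relation.Unary.Any using (here; there)
open import Data.Product using (Σ-syntax; _×_; _,_; proj₁)
open import Function using (_∘_)
open import Relation.Binary.PropositionalEquality
  using (_≡_; _≢_; refl; sym; trans; cong; cong₂; subst)

module ListSplit (K : Sort → Set) where
  open Logic K

  subT-renT : ∀ {Γ Δ Ξ σ} (θ : Sub Δ Ξ) (r : Ren Γ Δ) (t : Tm Γ σ) →
              subT θ (renT r t) ≡ subT (θ ∘ r) t
  subT-renT θ r (var x)  = refl
  subT-renT θ r (con c)  = refl
  subT-renT θ r z        = refl
  subT-renT θ r (s t)    = cong s (subT-renT θ r t)
  subT-renT θ r nil      = refl
  subT-renT θ r (x :: l) = cong₂ _::_ (subT-renT θ r x) (subT-renT θ r l)

  subT-var : ∀ {Γ σ} (t : Tm Γ σ) → subT var t ≡ t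
  subT-var (var x)  = refl
  subT-var (con c)  = refl
  subT-var z        = refl
  subT-var (s t)    = cong s (subT-var t)
  subT-var nil      = refl
  subT-var (x :: l) = cong₂ _::_ (subT-var x) (subT-var l)

  sub0-wkT : ∀ {Γ σ ρ} (u : Tm Γ ρ) (t : Tm Γ σ) → subT (sub0 u) (renT vs t) ≡ t
  sub0-wkT u t = trans (subT-renT (sub0 u) vs t) (subT-var t)

  ∷-injective : ∀ {Γ σ ss} {a b : Tm Γ σ} {as bs : Args Γ ss} →
                _≡_ {A = Args Γ (σ ∷ ss)} (a ∷ as) (b ∷ bs) → a ≡ b × as ≡ bs
  ∷-injective refl = refl , refl

  secondArgument : ∀ {Γ σ ρ ss} {a b : Tm Γ σ} {c d : Tm Γ ρ} {as bs : Args Γ ss} →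
                   _≡_ {A = Args Γ (σ ∷ ρ ∷ ss)} (a ∷ c ∷ as) (b ∷ d ∷ bs) → c ≡ d
  secondArgument refl = refl

  z≢s : ∀ {Γ} {I : Tm Γ nt} → z ≢ s I
  z≢s ()

  s-injective : ∀ {Γ} {I J : Tm Γ nt} → s I ≡ s J → I ≡ J
  s-injective refl = refl

  noVars : ∀ {Δ} → Sub [] Δ
  noVars ()

  Length : ∀ {Γ} → Tm Γ lst → Tm Γ nt → Fm Γ
  Length L I = atm lengthP (L ∷ I ∷ [])

  Split : ∀ {Γ} → Tm Γ lst → Tm Γ lst → Tm Γ lst → Fm Γ
  Split L₁ L₂ L₃ = atm splitP (L₁ ∷ L₂ ∷ L₃ ∷ [])

  MostGeneral : ∀ {Σ' Δ ss} {u : Args Σ' ss} {t : Args Δ ss} → Unifier u t → Set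
  MostGeneral {u = u} {t} θ = (ρ : Unifier u t) → ρ ≼ θ

  LeftPremise : ∀ {Σ' p} → Definition → Args Σ' (arity p) → List (Fm Σ') → Fm Σ' →
                Clause p → Set
  LeftPremise D u Γ C cl =
    Σ[ S ∈ List (Unifier u (Clause.head cl)) ]
      (CSU S × All (λ θ → D ⨾ Unifier.ctx θ ⊢
                            subF (Unifier.θΔ θ) (Clause.body cl) ∷ map (subF (Unifier.θΣ θ)) Γ
                            ⟶ subF (Unifier.θΣ θ) C) S)

  LeftPremises : ∀ {Σ'} → Definition → (p : Pred) → Args Σ' (arity p) → List (Fm Σ') → Fm Σ' →
                 Set
  LeftPremises D p u Γ C = (cl : Clause p) → cl ∈ D p → LeftPremise D u Γ C cl

  leftPremise-nonUnifiable : ∀ {Σ' p D Γ C} {u : Args Σ' (arity p)} (cl : Clause p) →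
                             (Unifier u (Clause.head cl) → ⊥) → LeftPremise D u Γ C cl
  leftPremise-nonUnifiable _ noUnifier = [] , ⊥-elim ∘ noUnifier , []

  leftPremise-mgu : ∀ {Σ' p D Γ C} {u : Args Σ' (arity p)} (cl : Clause p)
                    (θ : Unifier u (Clause.head cl)) → MostGeneral θ →
                    D ⨾ Unifier.ctx θ ⊢ subF (Unifier.θΔ θ) (Clause.body cl)
                                          ∷ map (subF (Unifier.θΣ θ)) Γ
                                      ⟶ subF (Unifier.θΣ θ) C →
                    LeftPremise D u Γ C cl
  leftPremise-mgu _ θ mgu d = θ ∷ [] , here ∘ mgu , d ∷ []

  variable-mgu : ∀ {Σ' σ} (t : Tm Σ' σ) → Unifier (t ∷ []) (var {σ ∷ []} vz ∷ [])
  variable-mgu {Σ'} t = record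
    { ctx = Σ' ; θΣ = var ; θΔ = θΔ ; unif = cong (_∷ []) (subT-var t) }
    where
      θΔ : Sub (_ ∷ []) Σ'
      θΔ vz = t

  variable-mgu-mostGeneral : ∀ {Σ' σ} (t : Tm Σ' σ) → MostGeneral (variable-mgu t)
  variable-mgu-mostGeneral t ρ = θΣ , (λ x → refl) , matchesTerm
    where
      open Unifier ρ
      matchesTerm : ∀ {σ} (x : Var (_ ∷ []) σ) → θΔ x ≡ subT θΣ (Unifier.θΔ (variable-mgu t) x)
      matchesTerm vz = sym (proj₁ (∷-injective unif))

  length-nil-mgu : ∀ {Σ'} → Unifier {lst ∷ Σ'} (var vz ∷ z ∷ []) (nil ∷ z ∷ [])
  length-nil-mgu {Σ'} = record { ctx = Σ' ; θΣ = sub0 nil ; θΔ = noVars ; unif = refl }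

  length-nil-mgu-mostGeneral : ∀ {Σ'} → MostGeneral (length-nil-mgu {Σ'})
  length-nil-mgu-mostGeneral ρ = θΣ ∘ vs , isNil , λ ()
    where
      open Unifier ρ
      isNil : ∀ {σ} (x : Var (lst ∷ _) σ) → θΣ x ≡ subT (θΣ ∘ vs) (sub0 nil x)
      isNil vz     = proj₁ (∷-injective unif)
      isNil (vs x) = refl

  -- The clause  length (X :: L) (s I) ≜ length L I  matched against  length l (s j),
  -- where l and j are the two newest eigenvariables: l becomes X :: L and j becomes I.
  consVars : ∀ {Σ'} → Sub (lst ∷ nt ∷ Σ') (tau ∷ lst ∷ nt ∷ Σ')
  consVars vz     = var vz :: var (vs vz)
  consVars (vs x) = var (vs (vs x))

  clauseVars : ∀ {Σ'} → Sub (tau ∷ lst ∷ nt ∷ []) (tau ∷ lst ∷ nt ∷ Σ')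
  clauseVars vz           = var vz
  clauseVars (vs vz)      = var (vs vz)
  clauseVars (vs (vs vz)) = var (vs (vs vz))

  length-cons-mgu : ∀ {Σ'} →
    Unifier {lst ∷ nt ∷ Σ'} (var vz ∷ s (var (vs vz)) ∷ [])
                            ((var vz :: var (vs vz)) ∷ s (var (vs (vs vz))) ∷ [])
  length-cons-mgu = record
    { ctx = tau ∷ lst ∷ nt ∷ _ ; θΣ = consVars ; θΔ = clauseVars ; unif = refl }

  length-cons-mgu-mostGeneral : ∀ {Σ'} → MostGeneral (length-cons-mgu {Σ'})
  length-cons-mgu-mostGeneral ρ = η , onEigenvariables , onClauseVariables
    where
      open Unifier ρ
      isCons : θΣ vz ≡ θΔ vz :: θΔ (vs vz)
      isCons = proj₁ (∷-injective unif)
      isPred : θΣ (vs vz) ≡ θΔ (vs (vs vz))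
      isPred = s-injective (secondArgument unif)
      η : Sub (tau ∷ lst ∷ nt ∷ _) ctx
      η vz          = θΔ vz
      η (vs vz)     = θΔ (vs vz)
      η (vs (vs x)) = θΣ (vs x)
      onEigenvariables : ∀ {σ} (x : Var (lst ∷ nt ∷ _) σ) → θΣ x ≡ subT η (consVars x)
      onEigenvariables vz     = isCons
      onEigenvariables (vs x) = refl
      onClauseVariables : ∀ {σ} (x : Var (tau ∷ lst ∷ nt ∷ []) σ) →
                          θΔ x ≡ subT η (clauseVars x)
      onClauseVariables vz           = refl
      onClauseVariables (vs vz)      = refl
      onClauseVariables (vs (vs vz)) = sym isPred

  splitR-nil : ∀ {Σ' Γ} → 𝒟list ⨾ Σ' ⊢ Γ ⟶ Split nil nil nil
  splitR-nil = defR _ (here refl) noVars refl topR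

  splitR-consʳ : ∀ {Σ' Γ X L₁ L₂ L₃} →
                 𝒟list ⨾ Σ' ⊢ Γ ⟶ Split L₁ L₂ L₃ →
                 𝒟list ⨾ Σ' ⊢ Γ ⟶ Split (X :: L₁) L₂ (X :: L₃)
  splitR-consʳ {Σ'} {X = X} {L₁} {L₂} {L₃} = defR _ (there (there (here refl))) θ refl
    where
      θ : Sub (tau ∷ lst ∷ lst ∷ lst ∷ []) Σ'
      θ vz                = X
      θ (vs vz)           = L₁
      θ (vs (vs vz))      = L₂
      θ (vs (vs (vs vz))) = L₃

  lengthL-z : ∀ {Σ' Γ C} →
              𝒟list ⨾ Σ' ⊢ ⊤' ∷ map (subF (sub0 nil)) Γ ⟶ subF (sub0 nil) C →
              𝒟list ⨾ lst ∷ Σ' ⊢ Length (var vz) z ∷ Γ ⟶ C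
  lengthL-z {Γ = Γ} {C} d = defL cases
    where
      cases : LeftPremises 𝒟list lengthP (var vz ∷ z ∷ []) Γ C
      cases cl (here refl) = leftPremise-mgu cl length-nil-mgu length-nil-mgu-mostGeneral d
      cases cl (there (here refl)) =
        leftPremise-nonUnifiable cl (z≢s ∘ secondArgument ∘ Unifier.unif)

  lengthL-s : ∀ {Σ' Γ C} →
              𝒟list ⨾ tau ∷ lst ∷ nt ∷ Σ' ⊢ Length (var (vs vz)) (var (vs (vs vz)))
                                              ∷ map (subF consVars) Γ
                                          ⟶ subF consVars C →
              𝒟list ⨾ lst ∷ nt ∷ Σ' ⊢ Length (var vz) (s (var (vs vz))) ∷ Γ ⟶ C
  lengthL-s {Γ = Γ} {C} d = defL cases
    where
      cases : LeftPremises 𝒟list lengthP (var vz ∷ s (var (vs vz)) ∷ []) Γ C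
      cases cl (here refl) =
        leftPremise-nonUnifiable cl (z≢s ∘ sym ∘ secondArgument ∘ Unifier.unif)
      cases cl (there (here refl)) =
        leftPremise-mgu cl length-cons-mgu length-cons-mgu-mostGeneral d

  SplitNilInvariant : ∀ {Σ'} → Fm (nt ∷ Σ')
  SplitNilInvariant = all lst (Length (var vz) (var (vs vz)) ⊃ Split (var vz) nil (var vz))

  splitNilInvariant-z : ∀ {Σ'} → 𝒟list ⨾ Σ' ⊢ [] ⟶ inst SplitNilInvariant z
  splitNilInvariant-z = allR (impR (lengthL-z splitR-nil))

  splitNilInvariant-s : ∀ {Σ'} →
                        𝒟list ⨾ nt ∷ Σ' ⊢ SplitNilInvariant ∷ [] ⟶ subF succ0 SplitNilInvariant
  splitNilInvariant-s =
    allR (impR (lengthL-s (splitR-consʳ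
      (exch (swap _ _ refl) (allL (var (vs vz)) (impL (init (atmA _ _)) (init (atmA _ _))))))))

  length⇒splitNil : ∀ {Σ' I L} →
                    𝒟list ⨾ Σ' ⊢ nat I ∧' Length L I ∷ [] ⟶ Split L nil L
  length⇒splitNil {Σ'} {I} {L} =
    contr (andL₁ (ind SplitNilInvariant splitNilInvariant-z splitNilInvariant-s
      -- instantiating the invariant at I leaves I weakened under the binder for l
      (allL L (subst (λ J → 𝒟list ⨾ Σ' ⊢ (Length L J ⊃ Split L nil L) ∷ (nat I ∧' Length L I) ∷ []
                                        ⟶ Split L nil L)
                     (sym (sub0-wkT L I))
                     (impL (andL₂ (init (atmA _ _))) (init (atmA _ _)))))))

  listSplitNil-derivable : Derivable 𝒟list listSplitNil
  listSplitNil-derivable = allR (impR (defL cases))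
    where
      cases : LeftPremises 𝒟list listP (var vz ∷ []) [] (Split (var vz) nil (var vz))
      cases cl (here refl) =
        leftPremise-mgu {C = Split (var vz) nil (var vz)} cl
          (variable-mgu (var vz)) (variable-mgu-mostGeneral (var vz)) (exL length⇒splitNil)

proposition2p6 : (K : Sort → Set) → Logic.Derivable K (Logic.𝒟list K) (Logic.listSplitNil K)
proposition2p6 K = ListSplit.listSplitNil-derivable K
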